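{- Let $A,B$ be sets. A relation $R \subseteq (A\times A)\times(B\times B)$, written $R(a_1,a_2,b_1,b_2)$, is a morphism $A\to B$ in $\mathrm{CPM}(\mathbf{Rel})$ if and only if for all $a_1,a_2\in A$, $b_1,b_2\in B$: $$R(a_1,a_2,b_1,b_2)\Rightarrow R(a_2,a_1,b_2,b_1)\qquad\text{and}\qquad R(a_1,a_2,b_1,b_2)\Rightarrow R(a_1,a_1,b_1,b_1).$$
   Context: $\mathbf{Rel}$ is the category of sets and binary relations; a relation $R: X\to Y$ is a subset of $X\times Y$, composition is $(S\circ R)(x,z)\iff\exists y.\,R(x,y)\wedge S(y,z)$, and the dagger is the converse $R^\dagger(y,x)\iff R(x,y)$. Its monoidal product is the cartesian product of sets, and every object is self-dual. A relation $P: X\to X$ is positive if $P = S^\dagger\circ S$ for some set $Y$ and relation $S: X\to Y$. The category $\mathrm{CPM}(\mathbf{Rel})$ has sets as objects; a morphism $A\to B$ is a relation $R\subseteq (A\times A)\times(B\times B)$ such that the relation $\overline{R}$ on $A\times B$ defined by $\overline{R}((a_1,b_1),(a_2,b_2))\iff R(a_2,a_1,b_2,b_1)$ is positive. Composition is relational composition: $(S\circ R)(a,a',c,c')\iff \exists b,b'.\,R(a,a',b,b')\wedge S(b,b',c,c')$. -}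

module Defs where

open import Data.Product using (Σ; ∃; _×_; _,_)
open import Function.Bundles using (_⇔_)

Relation : Set → Set → Set₁
Relation X Y = X → Y → Set

_∘ʳ_ : {X Y Z : Set} → Relation Y Z → Relation X Y → Relation X Z
(S ∘ʳ R) x z = ∃ λ y → R x y × S y z

_† : {X Y : Set} → Relation X Y → Relation Y X
(R †) y x = R x y

_≐_ : {X Y : Set} → Relation X Y → Relation X Y → Set
_≐_ {X} {Y} P Q = (x : X) (y : Y) → P x y ⇔ Q x y

Positive : {X : Set} → Relation X X → Set₁
Positive {X} P = Σ Set λ Y → Σ (Relation X Y) λ S → P ≐ ((S †) ∘ʳ S)

CPMRel : Set → Set → Set₁
CPMRel A B = A → A → B → B → Set

bar : {A B : Set} → CPMRel A B → Relation (A × B) (A × B)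
bar R (a₁ , b₁) (a₂ , b₂) = R a₂ a₁ b₂ b₁

IsCPMMorphism : {A B : Set} → CPMRel A B → Set₁
IsCPMMorphism R = Positive (bar R)

module Submission where

-- The heart of the matter is a fact about a single endorelation P on a set X:
-- P is positive (P = S† ∘ S for some S) iff P is symmetric and closed under
-- passing to the diagonal (P x z ⇒ P z z).
--   * If P = S† ∘ S, a witness y of P x z is shared by x and z, which gives
--     P z x (swap the two halves) and P z z (use the z half twice).
--   * Conversely, take as witnesses the pairs e = (p , q) with P p q, and let
--     x be S-related to e when x is an endpoint of e.  The edge (x , z) itself
--     witnesses (S† ∘ S) x z; a shared edge yields P x z by symmetry and
--     diagonal closure.
-- A relation R is a CPM(Rel) morphism iff its "bar" R̄ on A × B is positive,
-- and the two conditions on R̄ unfold to exactly the two conditions of the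
-- theorem, so lemma2p8 is this characterisation read through R̄.

open import Defs
open import Data.Product using (_×_; _,_)
open import Data.Sum using (_⊎_; inj₁; inj₂)
open import Function.Bundles using (_⇔_; mk⇔; Equivalence)
open import Relation.Binary.PropositionalEquality using (_≡_; refl)

open Equivalence using (to; from)

IsSymmetric : {X : Set} → Relation X X → Set
IsSymmetric {X} P = (x z : X) → P x z → P z x

IsDiagonalClosed : {X : Set} → Relation X X → Set
IsDiagonalClosed {X} P = (x z : X) → P x z → P z z

-- A positive relation is symmetric and diagonal-closed: a witness y of
-- P x z is S-related to both x and z.
positive⇒symmetric×diagonal : {X : Set} (P : Relation X X) →
  Positive P → IsSymmetric P × IsDiagonalClosed P
positive⇒symmetric×diagonal P (Y , S , P≐S†S) = symmetric , diagonal
  where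
  symmetric : IsSymmetric P
  symmetric x z p with to (P≐S†S x z) p
  ... | y , xSy , zSy = from (P≐S†S z x) (y , zSy , xSy)

  diagonal : IsDiagonalClosed P
  diagonal x z p with to (P≐S†S x z) p
  ... | y , _ , zSy = from (P≐S†S z z) (y , zSy , zSy)

Incidence : {X : Set} → Relation X X → Relation X (X × X)
Incidence P x (p , q) = P p q × (x ≡ p ⊎ x ≡ q)

symmetric×diagonal⇒positive : {X : Set} (P : Relation X X) →
  IsSymmetric P → IsDiagonalClosed P → Positive P
symmetric×diagonal⇒positive {X} P symmetric diagonal =
  (X × X) , Incidence P , λ x z → mk⇔ (edge x z) (shared x z)
  where
  edge : (x z : X) → P x z → ((Incidence P †) ∘ʳ Incidence P) x z
  edge x z p = (x , z) , (p , inj₁ refl) , (p , inj₂ refl)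

  shared : (x z : X) → ((Incidence P †) ∘ʳ Incidence P) x z → P x z
  shared x z ((p , q) , (pq , inj₁ refl) , (_ , inj₁ refl)) =
    diagonal q x (symmetric x q pq)
  shared x z ((p , q) , (pq , inj₁ refl) , (_ , inj₂ refl)) = pq
  shared x z ((p , q) , (pq , inj₂ refl) , (_ , inj₁ refl)) = symmetric p x pq
  shared x z ((p , q) , (pq , inj₂ refl) , (_ , inj₂ refl)) = diagonal p x pq

positive⇔symmetric×diagonal : {X : Set} (P : Relation X X) →
  Positive P ⇔ (IsSymmetric P × IsDiagonalClosed P)
positive⇔symmetric×diagonal P =
  mk⇔ (positive⇒symmetric×diagonal P)
      (λ (symmetric , diagonal) → symmetric×diagonal⇒positive P symmetric diagonal)

lemma2p8 : (A B : Set) (R : CPMRel A B) →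
    IsCPMMorphism R ⇔
    (((a₁ a₂ : A) (b₁ b₂ : B) → R a₁ a₂ b₁ b₂ → R a₂ a₁ b₂ b₁) ×
    ((a₁ a₂ : A) (b₁ b₂ : B) → R a₁ a₂ b₁ b₂ → R a₁ a₁ b₁ b₁))
lemma2p8 A B R = mk⇔
  (λ morphism → let (symmetric , diagonal) = to characterisation morphism in
     (λ a₁ a₂ b₁ b₂ → symmetric (a₂ , b₂) (a₁ , b₁)) ,
     (λ a₁ a₂ b₁ b₂ → diagonal (a₂ , b₂) (a₁ , b₁)))
  (λ (symmetric , diagonal) → from characterisation
     ( (λ { (a₂ , b₂) (a₁ , b₁) → symmetric a₁ a₂ b₁ b₂ })
     , (λ { (a₂ , b₂) (a₁ , b₁) → diagonal a₁ a₂ b₁ b₂ })))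
  where
  characterisation : IsCPMMorphism R ⇔ (IsSymmetric (bar R) × IsDiagonalClosed (bar R))
  characterisation = positive⇔symmetric×diagonal (bar R)
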